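{- Let $k\ge 3$ and $\ell\ge 2k-3$ be integers. Then the $k$-uniform hypergraph $K^{(k)}_{\ell,\ell}$ has a unique $2$-coloring (up to swapping the two colors): in every proper $2$-coloring, all vertices of $A$ receive one color and all vertices of $B$ receive the other color, where $A,B$ are the two vertex classes in the definition of $K^{(k)}_{\ell,\ell}$.
   Context: For integers $\ell\ge k-1$, $K^{(k)}_{\ell,\ell}$ is the $k$-uniform hypergraph with vertex set $A\cup B$, where $A,B$ are disjoint sets of size $\ell$, whose edges are all $k$-element sets having exactly one vertex in one of $A,B$ and the other $k-1$ vertices in the other set. A proper $2$-coloring of a $k$-uniform hypergraph is a map from its vertices to $\{0,1\}$ such that no edge is monochromatic. -}

module Defs where

open import Data.Nat using (ℕ; _∸_)
open import Data.Bool using (Bool; not)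
open import Data.Fin using (Fin)
open import Data.Fin.Subset using (Subset; ∣_∣; _∈_)
open import Data.Sum using (_⊎_; inj₁; inj₂)
open import Data.Product using (_×_; ∃-syntax)
open import Relation.Binary.PropositionalEquality using (_≡_)
open import Relation.Nullary using (¬_)

-- Vertex set of K^(k)_{ℓ,ℓ}: A = inj₁ (Fin ℓ), B = inj₂ (Fin ℓ).
Vertex : ℕ → Set
Vertex ℓ = Fin ℓ ⊎ Fin ℓ

record VSet (ℓ : ℕ) : Set where
  constructor vset
  field
    SA : Subset ℓ
    SB : Subset ℓ
open VSet public

_∈V_ : {ℓ : ℕ} → Vertex ℓ → VSet ℓ → Set
inj₁ a ∈V S = a ∈ SA S
inj₂ b ∈V S = b ∈ SB S

IsEdge : (k ℓ : ℕ) → VSet ℓ → Set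
IsEdge k ℓ S = (∣ SA S ∣ ≡ 1 × ∣ SB S ∣ ≡ k ∸ 1) ⊎ (∣ SA S ∣ ≡ k ∸ 1 × ∣ SB S ∣ ≡ 1)

Coloring : ℕ → Set
Coloring ℓ = Vertex ℓ → Bool

Monochromatic : {ℓ : ℕ} → Coloring ℓ → VSet ℓ → Set
Monochromatic {ℓ} c S = ∃[ col ] ((v : Vertex ℓ) → v ∈V S → c v ≡ col)

Proper : (k ℓ : ℕ) → Coloring ℓ → Set
Proper k ℓ c = (S : VSet ℓ) → IsEdge k ℓ S → ¬ Monochromatic c S

{-# OPTIONS --safe #-}

-- Let m = k ∸ 1, the size of the large part of an edge. Since ℓ ≥ 2m − 1, some colour x
-- occurs on at least m vertices of A. A vertex of B of colour x would form a monochromatic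
-- edge with m of them, so all of B has colour not x. As ℓ ≥ m, the same argument with A and
-- B exchanged shows that no vertex of A has colour not x.

module Submission where

open import Defs
open import Data.Nat using (ℕ; _≤_; _∸_; _*_; zero; suc; _+_; z≤n; s≤s; _≤?_)
open import Data.Nat.Properties using (+-suc; +-identityʳ; +-mono-≤; ≤-trans; m≤n+m; m+[n∸m]≡n; <⇒≤; ≰⇒>; n≮n)
open import Data.Bool using (Bool; not; true; false)
open import Data.Bool.Properties using (¬-not; not-involutive)
open import Data.Fin using (Fin)
open import Data.Empty using (⊥)
open import Data.Fin.Subset using (Subset; ∣_∣; _∈_; _⊆_; ⊤; ∁; ⁅_⁆; inside; outside) renaming (⊥ to ∅)
open import Data.Fin.Subset.Properties using (∣p∣≤n; ∣∁p∣≡n∸∣p∣; ∣⊤∣≡n; ⊥⊆; ∣⊥∣≡0; ∣⁅x⁆∣≡1; x∈⁅y⁆⇒x≡y; x∈∁p⇒x∉p)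
open import Data.Vec using ([]; _∷_; here; there; tabulate)
open import Data.Vec.Properties using ([]=⇒lookup; lookup⇒[]=; lookup∘tabulate)
open import Data.Sum using (_⊎_; inj₁; inj₂; swap)
open import Data.Product using (_×_; ∃-syntax; _,_)
open import Function using (_∘_)
open import Relation.Nullary using (yes; no; contradiction)
open import Relation.Binary.PropositionalEquality using (_≡_; refl; sym; trans; cong; subst)

private
  variable
    k ℓ n m : ℕ

pigeonhole : ∀ {a b} → m + m ≤ suc (a + b) → m ≤ a ⊎ m ≤ b
pigeonhole {m} {a} {b} bound with m ≤? a | m ≤? b
... | yes m≤a | _       = inj₁ m≤a
... | no _    | yes m≤b = inj₂ m≤b
... | no m≰a  | no m≰b  = contradiction too-small (n≮n (suc (a + b)))
  where
  too-small : suc (suc (a + b)) ≤ suc (a + b)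
  too-small = subst (_≤ suc (a + b)) (cong suc (+-suc a b))
    (≤-trans (+-mono-≤ (≰⇒> m≰a) (≰⇒> m≰b)) bound)

∣p∣+∣∁p∣≡n : (p : Subset n) → ∣ p ∣ + ∣ ∁ p ∣ ≡ n
∣p∣+∣∁p∣≡n p = trans (cong (∣ p ∣ +_) (∣∁p∣≡n∸∣p∣ p)) (m+[n∸m]≡n (∣p∣≤n p))

∃⊆-of-size : (p : Subset n) → m ≤ ∣ p ∣ → ∃[ q ] q ⊆ p × ∣ q ∣ ≡ m
∃⊆-of-size []            z≤n = [] , (λ ()) , refl
∃⊆-of-size (outside ∷ p) m≤∣p∣ with ∃⊆-of-size p m≤∣p∣
... | q , q⊆p , ∣q∣≡m = outside ∷ q , (λ { (there i∈q) → there (q⊆p i∈q) }) , ∣q∣≡m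
∃⊆-of-size {n = suc n} {m = zero} (inside ∷ p) _ = ∅ , ⊥⊆ , ∣⊥∣≡0 (suc n)
∃⊆-of-size {m = suc m}          (inside ∷ p) (s≤s m≤∣p∣) with ∃⊆-of-size p m≤∣p∣
... | q , q⊆p , ∣q∣≡m =
  inside ∷ q , (λ { here → here ; (there i∈q) → there (q⊆p i∈q) }) , cong suc ∣q∣≡m

Coloured : (Fin n → Bool) → Bool → Subset n → Set
Coloured f x p = ∀ {i} → i ∈ p → f i ≡ x

Coloured-⊆ : ∀ {f : Fin n → Bool} {x p q} → q ⊆ p → Coloured f x p → Coloured f x q
Coloured-⊆ q⊆p coloured = coloured ∘ q⊆p

-- Subsets are Boolean vectors (inside = true), so tabulate f is the colour class of true.
tabulate-Coloured : (f : Fin n → Bool) → Coloured f true (tabulate f)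
tabulate-Coloured f {i} i∈ = trans (sym (lookup∘tabulate f i)) ([]=⇒lookup i∈)

∈tabulate : (f : Fin n → Bool) {i : Fin n} → f i ≡ true → i ∈ tabulate f
∈tabulate f {i} fi≡true = lookup⇒[]= i (tabulate f) (trans (lookup∘tabulate f i) fi≡true)

∁tabulate-Coloured : (f : Fin n → Bool) → Coloured f false (∁ (tabulate f))
∁tabulate-Coloured f i∈ = ¬-not (x∈∁p⇒x∉p i∈ ∘ ∈tabulate f)

large-colour-class : (f : Fin n → Bool) → m + m ≤ suc n → ∃[ x ] ∃[ p ] Coloured f x p × m ≤ ∣ p ∣
large-colour-class {m = m} f bound
  with pigeonhole (subst (m + m ≤_) (cong suc (sym (∣p∣+∣∁p∣≡n (tabulate f)))) bound)
... | inj₁ large = true  , tabulate f     , tabulate-Coloured f  , large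
... | inj₂ large = false , ∁ (tabulate f) , ∁tabulate-Coloured f , large

IsEdge-swap : ∀ k SA SB → IsEdge k ℓ (vset SA SB) → IsEdge k ℓ (vset SB SA)
IsEdge-swap _ _ _ (inj₁ (∣SA∣≡1 , ∣SB∣≡k∸1)) = inj₂ (∣SB∣≡k∸1 , ∣SA∣≡1)
IsEdge-swap _ _ _ (inj₂ (∣SA∣≡k∸1 , ∣SB∣≡1)) = inj₁ (∣SB∣≡1 , ∣SA∣≡k∸1)

proper-swap : ∀ k {c : Coloring ℓ} → Proper k ℓ c → Proper k ℓ (c ∘ swap)
proper-swap k proper (vset SA SB) edge (x , mono) =
  proper (vset SB SA) (IsEdge-swap k SA SB edge)
    (x , λ { (inj₁ b) → mono (inj₂ b) ; (inj₂ a) → mono (inj₁ a) })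

¬Coloured-edge : ∀ k {c : Coloring ℓ} {x} SA SB → Proper k ℓ c → IsEdge k ℓ (vset SA SB) →
  Coloured (c ∘ inj₁) x SA → Coloured (c ∘ inj₂) x SB → ⊥
¬Coloured-edge _ _ _ proper edge colA colB =
  proper _ edge (_ , λ { (inj₁ a) → colA ; (inj₂ b) → colB })

other-side-forced : ∀ k {c : Coloring ℓ} {x} p → Proper k ℓ c →
  Coloured (c ∘ inj₁) x p → k ∸ 1 ≤ ∣ p ∣ → (b : Fin ℓ) → c (inj₂ b) ≡ not x
other-side-forced k {c} p proper coloured large b with ∃⊆-of-size p large
... | q , q⊆p , ∣q∣≡k-1 = ¬-not λ cb≡x →
  ¬Coloured-edge k q ⁅ b ⁆ proper (inj₂ (∣q∣≡k-1 , ∣⁅x⁆∣≡1 b)) (Coloured-⊆ q⊆p coloured)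
    (λ i∈⁅b⁆ → trans (cong (c ∘ inj₂) (x∈⁅y⁆⇒x≡y b i∈⁅b⁆)) cb≡x)

2k∸3≤ℓ⇒[k∸1]+[k∸1]≤1+ℓ : ∀ k → 2 * k ∸ 3 ≤ ℓ → (k ∸ 1) + (k ∸ 1) ≤ suc ℓ
2k∸3≤ℓ⇒[k∸1]+[k∸1]≤1+ℓ zero          _ = z≤n
2k∸3≤ℓ⇒[k∸1]+[k∸1]≤1+ℓ (suc zero)    _ = z≤n
2k∸3≤ℓ⇒[k∸1]+[k∸1]≤1+ℓ (suc (suc n)) bound rewrite +-identityʳ n | +-suc n (suc n) =
  s≤s bound

2k∸3≤ℓ⇒k∸1≤ℓ : 2 ≤ k → 2 * k ∸ 3 ≤ ℓ → k ∸ 1 ≤ ℓ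
2k∸3≤ℓ⇒k∸1≤ℓ {suc (suc n)} (s≤s (s≤s z≤n)) bound rewrite +-identityʳ n | +-suc n (suc n) =
  ≤-trans (m≤n+m (suc n) n) bound

claim2p1 : (k ℓ : ℕ) → 3 ≤ k → 2 * k ∸ 3 ≤ ℓ → (c : Coloring ℓ) → Proper k ℓ c →
    ∃[ col ] (((a : Fin ℓ) → c (inj₁ a) ≡ col) × ((b : Fin ℓ) → c (inj₂ b) ≡ not col))
claim2p1 k ℓ 3≤k bound c proper
  with large-colour-class (c ∘ inj₁) (2k∸3≤ℓ⇒[k∸1]+[k∸1]≤1+ℓ k bound)
... | x , p , coloured , large = x , A-coloured , B-coloured
  where
  B-coloured : (b : Fin ℓ) → c (inj₂ b) ≡ not x
  B-coloured = other-side-forced k p proper coloured large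

  A-coloured : (a : Fin ℓ) → c (inj₁ a) ≡ x
  A-coloured a = trans
    (other-side-forced k ⊤ (proper-swap k proper) (λ {b} _ → B-coloured b)
      (subst (k ∸ 1 ≤_) (sym (∣⊤∣≡n ℓ)) (2k∸3≤ℓ⇒k∸1≤ℓ (<⇒≤ 3≤k) bound)) a)
    (not-involutive x)
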